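{- Let $N$ be a species network and let $G$ be a rooted binary gene tree with a reconciliation $\alpha$ with $N$ (events $e$). Let $x,y,z$ be internal nodes of $G$ such that $y$ is a descendant of one child $x_l$ of $x$ and $z$ is a descendant of the other child $x_r$ of $x$. Suppose that $e(x,\mathrm{last})=\mathrm{S}$ and that for every node $w$ on the path between $x$ and $y$ or on the path between $x$ and $z$, $e(w,i)\notin\{\mathrm{T},\mathrm{TL}\}$ for every $i\in[|\alpha(w)|]$. Then $\alpha_{\mathrm{last}}(y)$ and $\alpha_{\mathrm{last}}(z)$ are incomparable in $T_0(N)$.
   Context: A species network $N$ is a rooted directed acyclic graph whose arcs are partitioned into principal arcs $E_p(N)$ and secondary arcs $E_s(N)$, such that $(V(N),E_p(N))$ is a rooted tree $T_0(N)$ spanning all nodes; endpoints of secondary arcs have one parent and one child in $T_0(N)$; and $N$ is time-consistent. A reconciliation of a rooted binary tree $G$ whose leaves are mapped to leaves of $N$ by $\sigma$ assigns to each $u\in V(G)$ a sequence $\alpha(u)=(\alpha_1(u),\dots,\alpha_\ell(u))$ of nodes of $N$ ($\alpha_{\mathrm{last}}(u)=\alpha_\ell(u)$) and events $e(u,i)$: for $i<\ell$, $(\alpha_i(u),\alpha_{i+1}(u))$ is an arc of $N$ with event $\mathrm{SL}$ (principal arc out of a node with two children in $T_0(N)$), $\emptyset$ (principal arc out of a node with one child in $T_0(N)$) or $\mathrm{TL}$ (secondary arc); a leaf $u$ has $\alpha_\ell(u)=\sigma(u)$; an internal $u$ with children $u',u''$ has last event $\mathrm{S}$ if $\alpha_1(u'),\alpha_1(u'')$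 are the two children of $\alpha_\ell(u)$ in $T_0(N)$, $\mathrm{D}$ if $\alpha_1(u')=\alpha_1(u'')=\alpha_\ell(u)$, and $\mathrm{T}$ if one of $(\alpha_\ell(u),\alpha_1(u'))$, $(\alpha_\ell(u),\alpha_1(u''))$ is a secondary arc and the other a principal arc. Two nodes are incomparable in $T_0(N)$ if neither is an ancestor of the other. -}

module Defs where

open import Data.Nat using (ℕ; suc; _<_)
open import Data.Fin using (Fin; inject₁; fromℕ) renaming (suc to fsuc; zero to fzero)
open import Data.Maybe using (Maybe; just; nothing)
open import Data.Product using (Σ; ∃; _×_; _,_)
open import Data.Sum using (_⊎_)
open import Data.Empty using (⊥)
open import Relation.Nullary using (¬_)
open import Relation.Binary.PropositionalEquality using (_≡_; _≢_)
open import Relation.Binary.Construct.Closure.ReflexiveTransitive using (Star)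
open import Relation.Binary.Construct.Closure.Transitive using (TransClosure)

HasOneChild : {A : Set} → (A → A → Set) → A → Set
HasOneChild P a = ∃ λ c → P a c × (∀ c' → P a c' → c' ≡ c)

HasTwoChildren : {A : Set} → (A → A → Set) → A → Set
HasTwoChildren P a =
  ∃ λ c₁ → ∃ λ c₂ → c₁ ≢ c₂ × P a c₁ × P a c₂ × (∀ c → P a c → c ≡ c₁ ⊎ c ≡ c₂)

HasOneParent : {A : Set} → (A → A → Set) → A → Set
HasOneParent P a = ∃ λ p → P p a × (∀ p' → P p' a → p' ≡ p)

record SpeciesNetwork : Set₁ where
  field
    n         : ℕ
    principal : Fin n → Fin n → Set
    secondary : Fin n → Fin n → Set
    root      : Fin n
    disjoint  : ∀ u v → principal u v → secondary u v → ⊥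
    -- (V(N), E_p(N)) is a rooted tree T₀(N) spanning all nodes, rooted at root
    rootNoParent : ∀ u → ¬ principal u root
    uniqueParent : ∀ v → v ≢ root → HasOneParent principal v
    spanning     : ∀ v → Star principal root v
    secondaryEnds : ∀ u v → secondary u v →
      (HasOneParent principal u × HasOneChild principal u) ×
      (HasOneParent principal v × HasOneChild principal v)
    acyclic : ∀ u → ¬ TransClosure (λ a b → principal a b ⊎ secondary a b) u u
    timeConsistent : ∃ λ (θ : Fin n → ℕ) →
      (∀ u v → principal u v → θ u < θ v) × (∀ u v → secondary u v → θ u ≡ θ v)

module _ (N : SpeciesNetwork) where
  open SpeciesNetwork N

  Node : Set
  Node = Fin n

  IsNLeaf : Node → Set
  IsNLeaf a = ∀ b → ¬ (principal a b ⊎ secondary a b)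

  AncT0 : Node → Node → Set
  AncT0 = Star principal

  IncomparableT0 : Node → Node → Set
  IncomparableT0 a b = ¬ AncT0 a b × ¬ AncT0 b a

record GeneTree : Set₁ where
  field
    m        : ℕ
    groot    : Fin m
    -- nothing = leaf; just (l , r) = internal node with children l and r
    children : Fin m → Maybe (Fin m × Fin m)
  Child : Fin m → Fin m → Set
  Child u v = ∃ λ w → children u ≡ just (v , w) ⊎ children u ≡ just (w , v)
  field
    childrenDistinct : ∀ u l r → children u ≡ just (l , r) → l ≢ r
    grootNoParent    : ∀ u → ¬ Child u groot
    gUniqueParent    : ∀ v → v ≢ groot → HasOneParent Child v
    gSpanning        : ∀ v → Star Child groot v

module _ (G : GeneTree) where
  open GeneTree G

  GNode : Set
  GNode = Fin m

  IsInternal : GNode → Set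
  IsInternal u = ∃ λ p → children u ≡ just p

  Desc : GNode → GNode → Set
  Desc u v = Star Child u v

data Event : Set where
  S D T SL TL ∅ C : Event   -- C: the (contemporary) event at leaves

module _ (N : SpeciesNetwork) where
  open SpeciesNetwork N

  -- condition on (α_i(u), α_{i+1}(u)) with event e(u,i), i < ℓ
  ArcStep : Fin n → Fin n → Event → Set
  ArcStep a b SL = principal a b × HasTwoChildren principal a
  ArcStep a b ∅  = principal a b × HasOneChild principal a
  ArcStep a b TL = secondary a b
  ArcStep a b _  = ⊥

  -- condition on the last event of an internal node u, with
  -- a = α_last(u), b₁ = α_1(u'), b₂ = α_1(u'')
  LastStep : Fin n → Fin n → Fin n → Event → Set
  LastStep a b₁ b₂ S = HasTwoChildren principal a × principal a b₁ × principal a b₂ × b₁ ≢ b₂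
  LastStep a b₁ b₂ D = b₁ ≡ a × b₂ ≡ a
  LastStep a b₁ b₂ T = (secondary a b₁ × principal a b₂) ⊎ (secondary a b₂ × principal a b₁)
  LastStep a b₁ b₂ _ = ⊥

record Reconciliation (N : SpeciesNetwork) (G : GeneTree)
                      (σ : GNode G → Node N) : Set where
  open SpeciesNetwork N
  open GeneTree G
  field
    len : Fin m → ℕ                               -- |α(u)| = suc (len u)
    α   : (u : Fin m) → Fin (suc (len u)) → Fin n
    e   : (u : Fin m) → Fin (suc (len u)) → Event
  last : (u : Fin m) → Fin (suc (len u))
  last u = fromℕ (len u)
  αlast : Fin m → Fin n
  αlast u = α u (last u)
  field
    steps    : ∀ u (i : Fin (len u)) → ArcStep N (α u (inject₁ i)) (α u (fsuc i)) (e u (inject₁ i))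
    leafCond : ∀ u → children u ≡ nothing → αlast u ≡ σ u × e u (last u) ≡ C
    nodeCond : ∀ u l r → children u ≡ just (l , r) →
               LastStep N (αlast u) (α l fzero) (α r fzero) (e u (last u))

module Submission where

-- Without transfers every arc used by α, inside a node's sequence or from a node to
-- its children, is a principal arc, so α only moves downwards in T₀(N) along a path
-- of G.  The speciation at x sends xl and xr to the two distinct children c₁ ≠ c₂ of
-- αlast x, so αlast y lies below c₁ and αlast z below c₂.  If one of them were below
-- the other, c₁ and c₂ would have a common descendant; ancestors of a node of a tree
-- are totally ordered, so one sibling would be below the other, closing a cycle
-- through their common parent.

open import Defs
open import Data.Maybe using (just; nothing)
open import Data.Product using (_×_; _,_; ∃; proj₁; proj₂)
open import Data.Sum using (_⊎_; inj₁; inj₂)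
open import Data.Fin using (Fin; inject₁) renaming (zero to fzero; suc to fsuc)
open import Data.Nat using (ℕ; suc)
open import Data.Empty using (⊥; ⊥-elim)
open import Relation.Nullary using (¬_)
open import Relation.Binary.PropositionalEquality using (_≡_; _≢_; refl; sym; trans; subst)
open import Relation.Binary.Construct.Closure.ReflexiveTransitive using (Star; ε; _◅_; _◅◅_)
open import Relation.Binary.Construct.Closure.Transitive using (TransClosure; [_]; _∷_)

module _ {A : Set} {P : A → A → Set} where

  chain⇒Star : (L : ℕ) (f : Fin (suc L) → A) →
    (∀ (i : Fin L) → P (f (inject₁ i)) (f (fsuc i))) → ∀ i → Star P (f fzero) (f i)
  chain⇒Star L       f step fzero    = ε
  chain⇒Star (suc L) f step (fsuc j) =
    step fzero ◅ chain⇒Star L (λ k → f (fsuc k)) (λ i → step (fsuc i)) j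

  Star-unsnoc : ∀ {a b} → Star P a b → a ≡ b ⊎ ∃ λ p → Star P a p × P p b
  Star-unsnoc ε = inj₁ refl
  Star-unsnoc (s ◅ rest) with Star-unsnoc rest
  ... | inj₁ refl          = inj₂ (_ , ε , s)
  ... | inj₂ (p , r , q)   = inj₂ (p , s ◅ r , q)

module PrincipalTree (N : SpeciesNetwork) where
  open SpeciesNetwork N

  Arc : Node N → Node N → Set
  Arc u v = principal u v ⊎ secondary u v

  parent-unique : ∀ {p a v} → principal p v → principal a v → p ≡ a
  parent-unique {p} {a} {v} pv av = trans (unique p pv) (sym (unique a av))
    where
    v≢root : v ≢ root
    v≢root refl = rootNoParent a av
    unique : ∀ p' → principal p' v → p' ≡ proj₁ (uniqueParent v v≢root)
    unique = proj₂ (proj₂ (uniqueParent v v≢root))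

  principal◅Star⇒Arc⁺ : ∀ {a b c} → principal a b → Star principal b c → TransClosure Arc a c
  principal◅Star⇒Arc⁺ s ε       = [ inj₁ s ]
  principal◅Star⇒Arc⁺ s (t ◅ r) = inj₁ s ∷ principal◅Star⇒Arc⁺ t r

  ancestor-of-child : ∀ {a b v} → principal a v → Star principal b v →
    b ≡ v ⊎ Star principal b a
  ancestor-of-child av bv with Star-unsnoc bv
  ... | inj₁ b≡v           = inj₁ b≡v
  ... | inj₂ (p , bp , pv) = inj₂ (subst (Star principal _) (parent-unique pv av) bp)

  common-descendant⇒comparable : ∀ {a b c} → Star principal a c → Star principal b c →
    Star principal a b ⊎ Star principal b a
  common-descendant⇒comparable ε bc = inj₂ bc
  common-descendant⇒comparable (s ◅ a'c) bc with common-descendant⇒comparable a'c bc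
  ... | inj₁ a'b = inj₁ (s ◅ a'b)
  ... | inj₂ ba' with ancestor-of-child s ba'
  ...   | inj₁ refl = inj₁ (s ◅ ε)
  ...   | inj₂ ba   = inj₂ ba

  sibling-not-ancestor : ∀ {a c₁ c₂} → principal a c₁ → principal a c₂ → c₁ ≢ c₂ →
    ¬ Star principal c₁ c₂
  sibling-not-ancestor {a} ac₁ ac₂ c₁≢c₂ c₁c₂ with Star-unsnoc c₁c₂
  ... | inj₁ c₁≡c₂          = c₁≢c₂ c₁≡c₂
  ... | inj₂ (p , c₁p , pc₂) =
    acyclic a (principal◅Star⇒Arc⁺ ac₁ (subst (Star principal _) (parent-unique pc₂ ac₂) c₁p))

  siblings-no-common-descendant : ∀ {a c₁ c₂ t} → principal a c₁ → principal a c₂ → c₁ ≢ c₂ →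
    Star principal c₁ t → Star principal c₂ t → ⊥
  siblings-no-common-descendant ac₁ ac₂ c₁≢c₂ c₁t c₂t with common-descendant⇒comparable c₁t c₂t
  ... | inj₁ c₁c₂ = sibling-not-ancestor ac₁ ac₂ c₁≢c₂ c₁c₂
  ... | inj₂ c₂c₁ = sibling-not-ancestor ac₂ ac₁ (λ eq → c₁≢c₂ (sym eq)) c₂c₁

  ArcStep⇒principal : ∀ {a b} ev → ev ≢ TL → ArcStep N a b ev → principal a b
  ArcStep⇒principal SL _  (ab , _) = ab
  ArcStep⇒principal ∅  _  (ab , _) = ab
  ArcStep⇒principal TL ¬TL _       = ⊥-elim (¬TL refl)
  ArcStep⇒principal S  _  ()
  ArcStep⇒principal D  _  ()
  ArcStep⇒principal T  _  ()
  ArcStep⇒principal C  _  ()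

  LastStep⇒descends : ∀ {a b₁ b₂} ev → ev ≢ T → LastStep N a b₁ b₂ ev →
    Star principal a b₁ × Star principal a b₂
  LastStep⇒descends S  _  (_ , ab₁ , ab₂ , _) = ab₁ ◅ ε , ab₂ ◅ ε
  LastStep⇒descends D  _  (refl , refl)       = ε , ε
  LastStep⇒descends T  ¬T _                   = ⊥-elim (¬T refl)
  LastStep⇒descends SL _  ()
  LastStep⇒descends TL _  ()
  LastStep⇒descends ∅  _  ()
  LastStep⇒descends C  _  ()

module TransferFree {N : SpeciesNetwork} {G : GeneTree} {σ : GNode G → Node N}
                    (R : Reconciliation N G σ) where
  open SpeciesNetwork N
  open GeneTree G
  open Reconciliation R
  open PrincipalTree N

  NoTransfer : GNode G → Set
  NoTransfer w = ∀ (i : Fin (suc (len w))) → e w i ≢ T × e w i ≢ TL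

  α-descends-within : ∀ w → NoTransfer w → Star principal (α w fzero) (αlast w)
  α-descends-within w noT = chain⇒Star (len w) (α w)
    (λ i → ArcStep⇒principal (e w (inject₁ i)) (proj₂ (noT (inject₁ i))) (steps w i)) (last w)

  α-descends-to-child : ∀ u v → Child u v → NoTransfer u → Star principal (αlast u) (α v fzero)
  α-descends-to-child u v (w , inj₁ uvw) noT =
    proj₁ (LastStep⇒descends (e u (last u)) (proj₁ (noT (last u))) (nodeCond u v w uvw))
  α-descends-to-child u v (w , inj₂ uwv) noT =
    proj₂ (LastStep⇒descends (e u (last u)) (proj₁ (noT (last u))) (nodeCond u w v uwv))

  α-descends-along-path : ∀ u v → Desc G u v →
    (∀ w → Desc G u w → Desc G w v → NoTransfer w) →
    Star principal (α u fzero) (αlast v)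
  α-descends-along-path u .u ε noT = α-descends-within u (noT u ε ε)
  α-descends-along-path u v (_◅_ {j = u'} uu' u'v) noT =
    α-descends-within u noTu ◅◅ α-descends-to-child u u' uu' noTu ◅◅
      α-descends-along-path u' v u'v (λ w u'w wv → noT w (uu' ◅ u'w) wv)
    where
    noTu : NoTransfer u
    noTu = noT u ε (uu' ◅ u'v)

mainTheorem6 : (N : SpeciesNetwork) (G : GeneTree) (σ : GNode G → Node N) →
    (∀ u → GeneTree.children G u ≡ nothing → IsNLeaf N (σ u)) →
    (R : Reconciliation N G σ) →
    (x y z xl xr : GNode G) →
    IsInternal G x → IsInternal G y → IsInternal G z →
    GeneTree.children G x ≡ just (xl , xr) →
    Desc G xl y → Desc G xr z →
    Reconciliation.e R x (Reconciliation.last R x) ≡ S →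
    (∀ w → (Desc G x w × Desc G w y) ⊎ (Desc G x w × Desc G w z) →
    ∀ (i : Fin (suc (Reconciliation.len R w))) →
    Reconciliation.e R w i ≢ T × Reconciliation.e R w i ≢ TL) →
    IncomparableT0 N (Reconciliation.αlast R y) (Reconciliation.αlast R z)
mainTheorem6 N G σ _ R x y z xl xr _ _ _ x↦xl,xr xl→y xr→z eₓ≡S noTransfer =
  (λ y→z → disjoint (xl↓y ◅◅ y→z) xr↓z) , (λ z→y → disjoint (xl↓y) (xr↓z ◅◅ z→y))
  where
  open SpeciesNetwork N using (principal)
  open Reconciliation R
  open PrincipalTree N
  open TransferFree R

  speciation : LastStep N (αlast x) (α xl fzero) (α xr fzero) S
  speciation = subst (LastStep N _ _ _) eₓ≡S (nodeCond x xl xr x↦xl,xr)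

  disjoint : ∀ {t} → Star principal (α xl fzero) t → Star principal (α xr fzero) t → ⊥
  disjoint = siblings-no-common-descendant
    (proj₁ (proj₂ speciation)) (proj₁ (proj₂ (proj₂ speciation))) (proj₂ (proj₂ (proj₂ speciation)))

  xl↓y : Star principal (α xl fzero) (αlast y)
  xl↓y = α-descends-along-path xl y xl→y
    (λ w xl→w w→y → noTransfer w (inj₁ ((xr , inj₁ x↦xl,xr) ◅ xl→w , w→y)))
  xr↓z : Star principal (α xr fzero) (αlast z)
  xr↓z = α-descends-along-path xr z xr→z
    (λ w xr→w w→z → noTransfer w (inj₂ ((xl , inj₂ x↦xl,xr) ◅ xr→w , w→z)))
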